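{- Let $\mathfrak F=\langle U,B\rangle$ be a 3-frame. (i) If $\mathfrak F$ is a betweenness frame, then $\mathsf{Cm}^{ps}(\mathfrak F)$ is a betweenness algebra. (ii) If $\mathfrak F$ is a weak betweenness frame, then $\mathsf{Cm}^{ps}(\mathfrak F)$ is a weak betweenness algebra. (iii) If $\mathfrak F$ is a strong betweenness frame, then $\mathsf{Cm}^{ps}(\mathfrak F)$ is a strong betweenness algebra.
   Context: A 3-frame is $\langle U,B\rangle$ with $U\ne\emptyset$, $B\subseteq U^3$. Frame axioms (for all $a,b,c$): (BT0) $B(a,a,a)$; (BT1) $B(a,b,c)\to B(c,b,a)$; (BT2) $B(a,b,c)\to B(a,a,b)$; (BT3) $B(a,b,c)\wedge B(a,c,b)\to b=c$; (BTW) $B(a,b,a)\to a=b$; (BT2s) $B(a,a,b)$. Betweenness frame: BT0–BT3; weak: BT0, BT1, BT2, BTW; strong: BT0, BT1, BT2s, BT3. $\mathsf{Cm}^{ps}(\mathfrak F)=\langle 2^U,\langle B\rangle,[\![B]\!]\rangle$ with $\langle B\rangle(X,Y)=\{u\mid\exists x\in X\,\exists y\in Y\ B(x,u,y)\}$, $[\![B]\!](X,Y)=\{u\mid X\times\{u\}\times Y\subseteq B\}$. For a Boolean algebra $A$ with binary $f,g$ (a PS-algebra: $f$ normal and additive in each argument, $g$ with $g(0,y)=g(x,0)=1$ and turning joins in each argument into meets), axioms: (ABT0) $x\le f(x,x)$; (ABT1$_f$) $f(x,y)\le f(y,x)$; (ABT1$_g$) $g(x,y)\le g(y,x)$; (ABT2)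 $y\cdot f(x,z)\le f(x\cdot f(x,y),z)$; (ABT3) $f(x,g(x,-y)\cdot y)\le y$; (wMIA) $x,y\ne 0\to g(x,y)\le f(x,y)$; (ABTW) $x\ne0\to g(x,x)\le x$; (ABT2$^s$) $y\ne0\to x\le f(x,y)$. Betweenness algebra: ABT0, ABT1$_f$, ABT1$_g$, ABT2, ABT3, wMIA. Weak: ABT0, ABT1$_f$, ABT1$_g$, ABT2, ABTW. Strong: a betweenness algebra satisfying ABT2$^s$. -}

module Defs where

open import Level using (0ℓ)
open import Data.Product using (Σ; ∃; _×_; _,_)
open import Data.Empty using (⊥)
open import Relation.Nullary using (¬_)
open import Relation.Binary.PropositionalEquality using (_≡_)
open import Relation.Unary using (Pred; _⊆_; _∪_; _∩_; ∁; ∅) renaming (U to Full)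

record ThreeFrame : Set₁ where
  field
    Carrier  : Set
    nonempty : ¬ (Carrier → ⊥)
    B        : Carrier → Carrier → Carrier → Set

module FrameAxioms (F : ThreeFrame) where
  open ThreeFrame F
  BT0  = ∀ a → B a a a
  BT1  = ∀ a b c → B a b c → B c b a
  BT2  = ∀ a b c → B a b c → B a a b
  BT3  = ∀ a b c → B a b c → B a c b → b ≡ c
  BTW  = ∀ a b → B a b a → a ≡ b
  BT2s = ∀ a b → B a a b

open FrameAxioms

IsBetweennessFrame : ThreeFrame → Set
IsBetweennessFrame F = BT0 F × BT1 F × BT2 F × BT3 F

IsWeakBetweennessFrame : ThreeFrame → Set
IsWeakBetweennessFrame F = BT0 F × BT1 F × BT2 F × BTW F

IsStrongBetweennessFrame : ThreeFrame → Set
IsStrongBetweennessFrame F = BT0 F × BT1 F × BT2s F × BT3 F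

record BAO2 : Set₂ where
  field
    Carrier : Set₁
    _≤_     : Carrier → Carrier → Set
    _≈_     : Carrier → Carrier → Set
    𝟘 𝟙     : Carrier
    _·_ _+_ : Carrier → Carrier → Carrier
    -_      : Carrier → Carrier
    f g     : Carrier → Carrier → Carrier
  infix 4 _≤_ _≈_
  infixl 7 _·_
  infixl 6 _+_

module AlgebraAxioms (A : BAO2) where
  open BAO2 A
  f-normal   = ∀ x → (f 𝟘 x ≈ 𝟘) × (f x 𝟘 ≈ 𝟘)
  f-additive = ∀ x y z → (f (x + y) z ≈ f x z + f y z) × (f z (x + y) ≈ f z x + f z y)
  g-conormal = ∀ x → (g 𝟘 x ≈ 𝟙) × (g x 𝟘 ≈ 𝟙)
  g-antiadd  = ∀ x y z → (g (x + y) z ≈ g x z · g y z) × (g z (x + y) ≈ g z x · g z y)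
  IsPS = f-normal × f-additive × g-conormal × g-antiadd
  ABT0  = ∀ x → x ≤ f x x
  ABT1f = ∀ x y → f x y ≤ f y x
  ABT1g = ∀ x y → g x y ≤ g y x
  ABT2  = ∀ x y z → y · f x z ≤ f (x · f x y) z
  ABT3  = ∀ x y → f x (g x (- y) · y) ≤ y
  wMIA  = ∀ x y → ¬ (x ≈ 𝟘) → ¬ (y ≈ 𝟘) → g x y ≤ f x y
  ABTW  = ∀ x → ¬ (x ≈ 𝟘) → g x x ≤ x
  ABT2s = ∀ x y → ¬ (y ≈ 𝟘) → x ≤ f x y

open AlgebraAxioms

IsBetweennessAlgebra : BAO2 → Set₁
IsBetweennessAlgebra A =
  IsPS A × ABT0 A × ABT1f A × ABT1g A × ABT2 A × ABT3 A × wMIA A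

IsWeakBetweennessAlgebra : BAO2 → Set₁
IsWeakBetweennessAlgebra A =
  IsPS A × ABT0 A × ABT1f A × ABT1g A × ABT2 A × ABTW A

IsStrongBetweennessAlgebra : BAO2 → Set₁
IsStrongBetweennessAlgebra A = IsBetweennessAlgebra A × ABT2s A

module _ (F : ThreeFrame) where
  open ThreeFrame F

  ⟨B⟩ : Pred Carrier 0ℓ → Pred Carrier 0ℓ → Pred Carrier 0ℓ
  ⟨B⟩ X Y u = ∃ λ x → ∃ λ y → X x × Y y × B x u y

  [[B]] : Pred Carrier 0ℓ → Pred Carrier 0ℓ → Pred Carrier 0ℓ
  [[B]] X Y u = ∀ x y → X x → Y y → B x u y

  Cmps : BAO2
  Cmps = record
    { Carrier = Pred Carrier 0ℓ
    ; _≤_ = _⊆_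
    ; _≈_ = λ X Y → (X ⊆ Y) × (Y ⊆ X)
    ; 𝟘 = ∅
    ; 𝟙 = Full
    ; _·_ = _∩_
    ; _+_ = _∪_
    ; -_ = ∁
    ; f = ⟨B⟩
    ; g = [[B]]
    }

{-# OPTIONS --safe #-}
-- Each algebra axiom is the frame axiom of the same name read pointwise through
-- ⟨B⟩ and [[B]]. Classical logic enters in two places only: a subset that is not
-- equal to ∅ has an element (wMIA, ABTW, ABT2ˢ), and ABT3, where BT3 refutes that a
-- point of f X (g X (- Y) · Y) lies outside Y.
module Submission where

open import Defs
open import Level using (0ℓ)
open import Function using (id)
open import Data.Product using (_×_; _,_)
open import Data.Sum using (inj₁; inj₂; [_,_])
open import Data.Unit using (tt)
open import Relation.Nullary using (¬_)
open import Relation.Binary.PropositionalEquality using (subst; sym)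
open import Relation.Unary using (Pred; Satisfiable; _⊆_; _∪_; _∩_; ∅)
open import Axiom.ExcludedMiddle using (ExcludedMiddle)
open import Axiom.DoubleNegationElimination using (DoubleNegationElimination; em⇒dne)

module ComplexAlgebra (F : ThreeFrame) where
  open ThreeFrame F
  open FrameAxioms F
  open AlgebraAxioms (Cmps F)

  private
    Subset = Pred Carrier 0ℓ

  ⟨B⟩-mono : {X X′ Y Y′ : Subset} → X ⊆ X′ → Y ⊆ Y′ → ⟨B⟩ F X Y ⊆ ⟨B⟩ F X′ Y′
  ⟨B⟩-mono X⊆X′ Y⊆Y′ (x , y , Xx , Yy , Bxuy) = x , y , X⊆X′ Xx , Y⊆Y′ Yy , Bxuy

  ⟨B⟩-distribʳ-∪ : (X Y Z : Subset) → ⟨B⟩ F (X ∪ Y) Z ⊆ ⟨B⟩ F X Z ∪ ⟨B⟩ F Y Z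
  ⟨B⟩-distribʳ-∪ _ _ _ (x , z , inj₁ Xx , Zz , Bxuz) = inj₁ (x , z , Xx , Zz , Bxuz)
  ⟨B⟩-distribʳ-∪ _ _ _ (x , z , inj₂ Yx , Zz , Bxuz) = inj₂ (x , z , Yx , Zz , Bxuz)

  ⟨B⟩-distribˡ-∪ : (X Y Z : Subset) → ⟨B⟩ F Z (X ∪ Y) ⊆ ⟨B⟩ F Z X ∪ ⟨B⟩ F Z Y
  ⟨B⟩-distribˡ-∪ _ _ _ (z , x , Zz , inj₁ Xx , Bzux) = inj₁ (z , x , Zz , Xx , Bzux)
  ⟨B⟩-distribˡ-∪ _ _ _ (z , x , Zz , inj₂ Yx , Bzux) = inj₂ (z , x , Zz , Yx , Bzux)

  [[B]]-antitone : {X X′ Y Y′ : Subset} → X′ ⊆ X → Y′ ⊆ Y → [[B]] F X Y ⊆ [[B]] F X′ Y′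
  [[B]]-antitone X′⊆X Y′⊆Y all x y X′x Y′y = all x y (X′⊆X X′x) (Y′⊆Y Y′y)

  [[B]]-∩ʳ-∪ : (X Y Z : Subset) → [[B]] F X Z ∩ [[B]] F Y Z ⊆ [[B]] F (X ∪ Y) Z
  [[B]]-∩ʳ-∪ _ _ _ (allX , allY) x z = [ allX x z , allY x z ]

  [[B]]-∩ˡ-∪ : (X Y Z : Subset) → [[B]] F Z X ∩ [[B]] F Z Y ⊆ [[B]] F Z (X ∪ Y)
  [[B]]-∩ˡ-∪ _ _ _ (allX , allY) z x Zz = [ allX z x Zz , allY z x Zz ]

  Cmps-isPS : IsPS
  Cmps-isPS = ⟨B⟩-normal , ⟨B⟩-additive , [[B]]-conormal , [[B]]-antiadditive
    where
    ⟨B⟩-normal : f-normal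
    ⟨B⟩-normal _ = ((λ { (_ , _ , () , _) }) , λ ()) , ((λ { (_ , _ , _ , () , _) }) , λ ())

    ⟨B⟩-additive : f-additive
    ⟨B⟩-additive X Y Z =
        (⟨B⟩-distribʳ-∪ X Y Z , [ ⟨B⟩-mono inj₁ id , ⟨B⟩-mono inj₂ id ])
      , (⟨B⟩-distribˡ-∪ X Y Z , [ ⟨B⟩-mono id inj₁ , ⟨B⟩-mono id inj₂ ])

    [[B]]-conormal : g-conormal
    [[B]]-conormal _ = ((λ _ → tt) , λ _ _ _ ()) , ((λ _ → tt) , λ _ _ _ _ ())

    [[B]]-antiadditive : g-antiadd
    [[B]]-antiadditive X Y Z =
        ((λ all → [[B]]-antitone inj₁ id all , [[B]]-antitone inj₂ id all) , [[B]]-∩ʳ-∪ X Y Z)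
      , ((λ all → [[B]]-antitone id inj₁ all , [[B]]-antitone id inj₂ all) , [[B]]-∩ˡ-∪ X Y Z)

  nonzero⇒satisfiable : DoubleNegationElimination 0ℓ →
                        (X : Subset) → ¬ ((X ⊆ ∅) × (∅ ⊆ X)) → Satisfiable X
  nonzero⇒satisfiable dne X X≉∅ = dne λ ¬∃X → X≉∅ ((λ Xx → ¬∃X (_ , Xx)) , λ ())

  BT0⇒ABT0 : BT0 → ABT0
  BT0⇒ABT0 bt0 _ {u} Xu = u , u , Xu , Xu , bt0 u

  BT1⇒ABT1f : BT1 → ABT1f
  BT1⇒ABT1f bt1 _ _ (x , y , Xx , Yy , Bxuy) = y , x , Yy , Xx , bt1 x _ y Bxuy

  BT1⇒ABT1g : BT1 → ABT1g
  BT1⇒ABT1g bt1 _ _ all y x Yy Xx = bt1 x _ y (all x y Xx Yy)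

  BT2⇒ABT2 : BT2 → ABT2
  BT2⇒ABT2 bt2 _ _ _ {u} (Yu , x , z , Xx , Zz , Bxuz) =
    x , z , (Xx , x , u , Xx , Yu , bt2 x u z Bxuz) , Zz , Bxuz

  BT3⇒ABT3 : DoubleNegationElimination 0ℓ → BT3 → ABT3
  BT3⇒ABT3 dne bt3 _ Y {u} (x , c , Xx , (all , Yc) , Bxuc) =
    dne λ ¬Yu → ¬Yu (subst Y (sym (bt3 x u c Bxuc (all x u Xx ¬Yu))) Yc)

  Cmps-wMIA : DoubleNegationElimination 0ℓ → wMIA
  Cmps-wMIA dne X Y X≉∅ Y≉∅ all
    with nonzero⇒satisfiable dne X X≉∅ | nonzero⇒satisfiable dne Y Y≉∅
  ... | x , Xx | y , Yy = x , y , Xx , Yy , all x y Xx Yy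

  BTW⇒ABTW : DoubleNegationElimination 0ℓ → BTW → ABTW
  BTW⇒ABTW dne btw X X≉∅ all with nonzero⇒satisfiable dne X X≉∅
  ... | x , Xx = subst X (btw x _ (all x x Xx Xx)) Xx

  BT2s⇒ABT2s : DoubleNegationElimination 0ℓ → BT2s → ABT2s
  BT2s⇒ABT2s dne bt2s _ Y Y≉∅ {u} Xu with nonzero⇒satisfiable dne Y Y≉∅
  ... | y , Yy = u , y , Xu , Yy , bt2s u y

  BT2s⇒BT2 : BT2s → BT2
  BT2s⇒BT2 bt2s a b _ _ = bt2s a b

  strong⇒betweennessFrame : IsStrongBetweennessFrame F → IsBetweennessFrame F
  strong⇒betweennessFrame (bt0 , bt1 , bt2s , bt3) = bt0 , bt1 , BT2s⇒BT2 bt2s , bt3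

theorem6p6 : ExcludedMiddle 0ℓ → (F : ThreeFrame) →
    (IsBetweennessFrame F → IsBetweennessAlgebra (Cmps F)) ×
    (IsWeakBetweennessFrame F → IsWeakBetweennessAlgebra (Cmps F)) ×
    (IsStrongBetweennessFrame F → IsStrongBetweennessAlgebra (Cmps F))
theorem6p6 em F = betweenness , weak , strong
  where
  open ComplexAlgebra F

  dne : DoubleNegationElimination 0ℓ
  dne = em⇒dne em

  betweenness : IsBetweennessFrame F → IsBetweennessAlgebra (Cmps F)
  betweenness (bt0 , bt1 , bt2 , bt3) =
    Cmps-isPS , BT0⇒ABT0 bt0 , BT1⇒ABT1f bt1 , BT1⇒ABT1g bt1 , BT2⇒ABT2 bt2
    , BT3⇒ABT3 dne bt3 , Cmps-wMIA dne

  weak : IsWeakBetweennessFrame F → IsWeakBetweennessAlgebra (Cmps F)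
  weak (bt0 , bt1 , bt2 , btw) =
    Cmps-isPS , BT0⇒ABT0 bt0 , BT1⇒ABT1f bt1 , BT1⇒ABT1g bt1 , BT2⇒ABT2 bt2 , BTW⇒ABTW dne btw

  strong : IsStrongBetweennessFrame F → IsStrongBetweennessAlgebra (Cmps F)
  strong frame@(_ , _ , bt2s , _) =
    betweenness (strong⇒betweennessFrame frame) , BT2s⇒ABT2s dne bt2s
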